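{- Let $k\ge 1$, let $j_1,\dots,j_h\le k$ be distinct positive integers and let $a_1,\dots,a_h$ be positive integers. Then \[ \mathbb{E}\,|\mathscr{L}(\mathbf{X}_k)|\,X_{j_1}^{a_1}\cdots X_{j_h}^{a_h} \le \frac{C_{a_1,\dots,a_h}}{j_1\cdots j_h}\,\mathbb{E}|\mathscr{L}(\mathbf{X}_k)|, \] with $C_{a_1,\dots,a_h}=\prod_{i=1}^h (B_{a_i}+B_{a_i+1})$. In particular, for $h=1$ and $a_1=1$ one may take the constant $C_1=3$.
   Context: $X_1,X_2,\dots$ are independent random variables with $X_i$ Poisson distributed with parameter $1/i$, and $\mathbf{X}_k=(X_1,\dots,X_k)$. For a finite list $\mathbf{c}=(c_1,\dots,c_k)$ of non-negative integers, $\mathscr{L}(\mathbf{c}) = \{m_1+2m_2+\cdots+km_k : 0\le m_j\le c_j \text{ for } j=1,\dots,k\}$. $B_m$ denotes the $m$-th Bell number ($B_1=1,B_2=2,B_3=5,B_4=15,\dots$), i.e. the $m$-th moment of a Poisson random variable with parameter $1$. -}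

module Defs where

open import Data.Nat as ℕ using (ℕ; zero; suc)
open import Data.Integer using (+_)
open import Data.Fin using (Fin; toℕ)
open import Data.Vec using (Vec; []; _∷_; toList; lookup)
open import Data.List using (List; []; _∷_; [_]; map; concatMap; upTo; length; deduplicate; foldr)
open import Data.Rational using (ℚ; _/_; 0ℚ; 1ℚ; _+_; _*_)

toℚ : ℕ → ℚ
toℚ n = + n / 1

sumℚ : List ℚ → ℚ
sumℚ = foldr _+_ 0ℚ

prodℕ : (h : ℕ) → (Fin h → ℕ) → ℕ
prodℕ zero f = 1
prodℕ (suc h) f = f Fin.zero ℕ.* prodℕ h (λ t → f (Fin.suc t))
  where import Data.Fin as Fin

prodℚ : (h : ℕ) → (Fin h → ℚ) → ℚ
prodℚ zero f = 1ℚ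
prodℚ (suc h) f = f Fin.zero * prodℚ h (λ t → f (Fin.suc t))
  where import Data.Fin as Fin

-- 𝓛(c) = { m_1 + 2 m_2 + ... + k m_k : 0 ≤ m_j ≤ c_j }
-- sumsFrom w cs lists (with repetitions) all values  Σ_t (w+t) m_t,
-- 0 ≤ m_t ≤ c_t, where cs = (c_0, c_1, ...) carries weights w, w+1, ...
sumsFrom : ℕ → List ℕ → List ℕ
sumsFrom w [] = [ 0 ]
sumsFrom w (c ∷ cs) =
  concatMap (λ m → map (λ s → m ℕ.* w ℕ.+ s) (sumsFrom (suc w) cs)) (upTo (suc c))

-- the set 𝓛(c) as a duplicate-free list; entry i of c is c_{i+1}
𝓛 : {k : ℕ} → Vec ℕ k → List ℕ
𝓛 c = deduplicate ℕ._≟_ (sumsFrom 1 (toList c))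

card𝓛 : {k : ℕ} → Vec ℕ k → ℕ
card𝓛 c = length (𝓛 c)

stirling2 : ℕ → ℕ → ℕ
stirling2 zero zero = 1
stirling2 zero (suc j) = 0
stirling2 (suc n) zero = 0
stirling2 (suc n) (suc j) = suc j ℕ.* stirling2 n (suc j) ℕ.+ stirling2 n j

bell : ℕ → ℕ
bell n = foldr ℕ._+_ 0 (map (stirling2 n) (upTo (suc n)))

-- Poisson(1/(i+1)) probability mass at m, WITHOUT the factor e^{-1/(i+1)}:
--   (1/(i+1))^m / m!
poisNoExp : ℕ → ℕ → ℚ
poisNoExp i zero = 1ℚ
poisNoExp i (suc m) = poisNoExp i m * ((+ 1) / suc i) * ((+ 1) / suc m)

-- joint weight of (X_{w+1}, X_{w+2}, ...) = ms, without exponential factors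
weightFrom : ℕ → List ℕ → ℚ
weightFrom w [] = 1ℚ
weightFrom w (m ∷ ms) = poisNoExp w m * weightFrom (suc w) ms

-- P(X_k = m) · e^{H_k}, where H_k = 1 + 1/2 + ... + 1/k
weight : {k : ℕ} → Vec ℕ k → ℚ
weight m = weightFrom 0 (toList m)

box : (k N : ℕ) → List (Vec ℕ k)
box zero N = [ [] ]
box (suc k) N = concatMap (λ m → map (m ∷_) (box k N)) (upTo (suc N))

-- e^{H_k} · Σ_{m ∈ {0..N}^k} f(m) P(X_k = m) : partial sums of e^{H_k} E f(X_k)
partialE : (k N : ℕ) → (Vec ℕ k → ℕ) → ℚ
partialE k N f = sumℚ (map (λ m → toℚ (f m) * weight m) (box k N))

-- the moment  X_{j_1}^{a_1} ⋯ X_{j_h}^{a_h}  (j t is 0-based: X_{toℕ (j t) + 1})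
monomial : {k h : ℕ} → (Fin h → Fin k) → (Fin h → ℕ) → Vec ℕ k → ℕ
monomial {h = h} j a m = prodℕ h (λ t → lookup m (j t) ℕ.^ a t)

constC : (h : ℕ) → (Fin h → ℕ) → ℕ
constC h a = prodℕ h (λ t → bell (a t) ℕ.+ bell (suc (a t)))

invProdJ : {k h : ℕ} → (Fin h → Fin k) → ℚ
invProdJ {h = h} j = prodℚ h (λ t → (+ 1) / suc (toℕ (j t)))

module Submission where

-- The argument treats one factor X_j^a at a time.  Switching coordinate j
-- off (m ↦ m⁰ = m[j]≔0) gives L(m⁰) ≤ L(m) ≤ (m_j + 1) L(m⁰), and L(m⁰) and
-- the remaining factors do not depend on m_j.  The product structure of
-- the law of X therefore reduces the factor to the one-dimensional estimate
--   E[X^a (X+1)] ≤ (B_a + B_{a+1}) λ   for X ~ Poisson(λ), λ = 1/j,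
-- which also holds on every truncation {0,…,N}: expand x^a into falling
-- factorials via Stirling numbers and use (x+1) P(X=x+1) = λ P(X=x).

open import Algebra.Bundles using (CommutativeSemiring; CommutativeRing)
open import Data.Nat using (ℕ; zero; suc)
open import Data.List using (List; []; _∷_; map; concatMap; upTo; applyUpTo; foldr; _++_)

module Sums {c ℓ} (R : CommutativeSemiring c ℓ) where

  open CommutativeSemiring R
  open import Algebra.Properties.CommutativeSemigroup +-commutativeSemigroup using (interchange)
  open import Relation.Binary.Reasoning.Setoid setoid

  Σ< : ℕ → (ℕ → Carrier) → Carrier
  Σ< zero    f = 0#
  Σ< (suc M) f = f 0 + Σ< M (λ x → f (suc x))

  Σ∈ : {A : Set} → List A → (A → Carrier) → Carrier
  Σ∈ xs f = foldr _+_ 0# (map f xs)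

  Σ<-cong : ∀ M {f g : ℕ → Carrier} → (∀ x → f x ≈ g x) → Σ< M f ≈ Σ< M g
  Σ<-cong zero    f≈g = refl
  Σ<-cong (suc M) f≈g = +-cong (f≈g 0) (Σ<-cong M (λ x → f≈g (suc x)))

  Σ<-zero : ∀ M → Σ< M (λ _ → 0#) ≈ 0#
  Σ<-zero zero    = refl
  Σ<-zero (suc M) = trans (+-identityˡ _) (Σ<-zero M)

  Σ<-+ : ∀ M (f g : ℕ → Carrier) → Σ< M (λ x → f x + g x) ≈ Σ< M f + Σ< M g
  Σ<-+ zero    f g = sym (+-identityˡ 0#)
  Σ<-+ (suc M) f g = begin
    (f 0 + g 0) + Σ< M (λ x → f (suc x) + g (suc x))
      ≈⟨ +-congˡ (Σ<-+ M (λ x → f (suc x)) (λ x → g (suc x))) ⟩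
    (f 0 + g 0) + (Σ< M (λ x → f (suc x)) + Σ< M (λ x → g (suc x)))
      ≈⟨ interchange (f 0) (g 0) _ _ ⟩
    (f 0 + Σ< M (λ x → f (suc x))) + (g 0 + Σ< M (λ x → g (suc x))) ∎

  Σ<-*ˡ : ∀ M (a : Carrier) (f : ℕ → Carrier) → Σ< M (λ x → a * f x) ≈ a * Σ< M f
  Σ<-*ˡ zero    a f = sym (zeroʳ a)
  Σ<-*ˡ (suc M) a f =
    trans (+-congˡ (Σ<-*ˡ M a (λ x → f (suc x)))) (sym (distribˡ a (f 0) _))

  Σ<-*ʳ : ∀ M (a : Carrier) (f : ℕ → Carrier) → Σ< M (λ x → f x * a) ≈ Σ< M f * a
  Σ<-*ʳ M a f = trans (Σ<-cong M (λ x → *-comm (f x) a)) (trans (Σ<-*ˡ M a f) (*-comm a _))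

  Σ<-last : ∀ M (f : ℕ → Carrier) → Σ< (suc M) f ≈ Σ< M f + f M
  Σ<-last zero    f = trans (+-identityʳ (f 0)) (sym (+-identityˡ (f 0)))
  Σ<-last (suc M) f =
    trans (+-congˡ (Σ<-last M (λ x → f (suc x)))) (sym (+-assoc (f 0) _ _))

  Σ<-swap : ∀ M L (F : ℕ → ℕ → Carrier) →
            Σ< M (λ x → Σ< L (F x)) ≈ Σ< L (λ l → Σ< M (λ x → F x l))
  Σ<-swap zero    L F = sym (Σ<-zero L)
  Σ<-swap (suc M) L F = trans (+-congˡ (Σ<-swap M L (λ x → F (suc x))))
                              (sym (Σ<-+ L (F 0) (λ l → Σ< M (λ x → F (suc x) l))))

  Σ∈-applyUpTo : ∀ M (g : ℕ → ℕ) (f : ℕ → Carrier) → Σ∈ (applyUpTo g M) f ≈ Σ< M (λ x → f (g x))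
  Σ∈-applyUpTo zero    g f = refl
  Σ∈-applyUpTo (suc M) g f = +-congˡ (Σ∈-applyUpTo M (λ x → g (suc x)) f)

  Σ∈-upTo : ∀ M (f : ℕ → Carrier) → Σ∈ (upTo M) f ≈ Σ< M f
  Σ∈-upTo M f = Σ∈-applyUpTo M (λ x → x) f

  Σ∈-cong : {A : Set} (xs : List A) {f g : A → Carrier} → (∀ x → f x ≈ g x) → Σ∈ xs f ≈ Σ∈ xs g
  Σ∈-cong []       f≈g = refl
  Σ∈-cong (x ∷ xs) f≈g = +-cong (f≈g x) (Σ∈-cong xs f≈g)

  Σ∈-++ : {A : Set} (xs ys : List A) (f : A → Carrier) → Σ∈ (xs ++ ys) f ≈ Σ∈ xs f + Σ∈ ys f
  Σ∈-++ []       ys f = sym (+-identityˡ _)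
  Σ∈-++ (x ∷ xs) ys f = trans (+-congˡ (Σ∈-++ xs ys f)) (sym (+-assoc (f x) _ _))

  Σ∈-concatMap : {A B : Set} (F : A → List B) (xs : List A) (f : B → Carrier) →
                 Σ∈ (concatMap F xs) f ≈ Σ∈ xs (λ x → Σ∈ (F x) f)
  Σ∈-concatMap F []       f = refl
  Σ∈-concatMap F (x ∷ xs) f =
    trans (Σ∈-++ (F x) (concatMap F xs) f) (+-congˡ (Σ∈-concatMap F xs f))

  Σ∈-map : {A B : Set} (g : A → B) (xs : List A) (f : B → Carrier) → Σ∈ (map g xs) f ≈ Σ∈ xs (λ x → f (g x))
  Σ∈-map g []       f = refl
  Σ∈-map g (x ∷ xs) f = +-congˡ (Σ∈-map g xs f)

  Σ∈-*ˡ : {A : Set} (xs : List A) (a : Carrier) (f : A → Carrier) → Σ∈ xs (λ x → a * f x) ≈ a * Σ∈ xs f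
  Σ∈-*ˡ []       a f = sym (zeroʳ a)
  Σ∈-*ˡ (x ∷ xs) a f = trans (+-congˡ (Σ∈-*ˡ xs a f)) (sym (distribˡ a (f x) _))

open import Defs
open import Data.Nat using (ℕ; _≤_) renaming (_*_ to _*ℕ_)
open import Data.Fin using (Fin)
open import Data.Product using (∃)
open import Data.Rational using (ℚ; _+_; _*_; 0ℚ) renaming (_≤_ to _≤ℚ_; _<_ to _<ℚ_)
open import Function.Definitions using (Injective)
open import Relation.Binary.PropositionalEquality using (_≡_)

open import Data.Nat as ℕ using (_<_; z≤n; s≤s; _^_; _∸_) renaming (_+_ to _+ℕ_)
import Data.Nat.Properties as ℕP
import Data.Nat.Solver as ℕSolver
import Data.Integer as ℤ
import Data.Integer.Properties as ℤP
import Data.Integer.Solver as ℤSolver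
open import Data.Rational as ℚ using (1ℚ; toℚᵘ)
import Data.Rational.Properties as ℚP
import Data.Rational.Solver as ℚSolver
open import Data.Rational.Unnormalised as ℚᵘ using (mkℚᵘ; *≡*; *≤*) renaming (_≃_ to _≃ᵘ_)
import Data.Rational.Unnormalised.Properties as ℚᵘP
open import Data.Fin using (toℕ) renaming (zero to fzero; suc to fsuc)
open import Data.Fin.Properties using (0≢1+n; suc-injective)
open import Data.Vec using (Vec; []; _∷_; toList; lookup; _[_]≔_)
open import Data.Vec.Properties using ([]≔-idempotent; lookup∘update′)
open import Data.List using (length; cartesianProductWith)
open import Data.List.Properties using (length-map; length-++; length-upTo; length-removeAt′)
open import Data.List.Membership.Propositional using (_∈_; find)
open import Data.List.Membership.Propositional.Properties
  using (∈-concatMap⁺; ∈-concatMap⁻; ∈-map⁺; ∈-map⁻; ∈-upTo⁺; ∈-upTo⁻; ∈-cartesianProductWith⁺; ∈-deduplicate⁺; ∈-deduplicate⁻)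
open import Data.List.Relation.Unary.Any as Any using (here; there; _─_)
import Data.List.Relation.Unary.All as All
open import Data.List.Relation.Unary.AllPairs using (_∷_)
open import Data.List.Relation.Unary.Unique.Propositional using (Unique)
open import Data.List.Relation.Unary.Unique.DecPropositional.Properties using (deduplicate-!)
open import Data.Product using (_×_; _,_)
open import Data.Empty using (⊥-elim)
open import Function using (_∘_)
open import Relation.Binary.PropositionalEquality using (_≢_; refl; sym; trans; cong; cong₂; subst; module ≡-Reasoning)

open Sums (CommutativeRing.commutativeSemiring ℚP.+-*-commutativeRing)
module ℕΣ = Sums ℕP.+-*-commutativeSemiring

module ℤ+* = ℤSolver.+-*-Solver
module ℕ+* = ℕSolver.+-*-Solver
module ℚ+* = ℚSolver.+-*-Solver

toℚᵘ-/ : ∀ n d → toℚᵘ (ℤ.+ n ℚ./ suc d) ≃ᵘ mkℚᵘ (ℤ.+ n) d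
toℚᵘ-/ n d = ℚP.toℚᵘ-fromℚᵘ (mkℚᵘ (ℤ.+ n) d)

toℚ-+ : ∀ a b → toℚ (a +ℕ b) ≡ toℚ a + toℚ b
toℚ-+ a b = ℚP.toℚᵘ-injective (begin
  toℚᵘ (toℚ (a +ℕ b))                   ≈⟨ toℚᵘ-/ (a +ℕ b) 0 ⟩
  mkℚᵘ (ℤ.+ (a +ℕ b)) 0                 ≈⟨ *≡* cross-multiplied ⟩
  mkℚᵘ (ℤ.+ a) 0 ℚᵘ.+ mkℚᵘ (ℤ.+ b) 0    ≈⟨ ℚᵘP.+-cong (ℚᵘP.≃-sym (toℚᵘ-/ a 0)) (ℚᵘP.≃-sym (toℚᵘ-/ b 0)) ⟩
  toℚᵘ (toℚ a) ℚᵘ.+ toℚᵘ (toℚ b)        ≈⟨ ℚᵘP.≃-sym (ℚP.toℚᵘ-homo-+ (toℚ a) (toℚ b)) ⟩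
  toℚᵘ (toℚ a + toℚ b)                  ∎)
  where
  open ℚᵘP.≃-Reasoning
  cross-multiplied : ℤ.+ (a +ℕ b) ℤ.* ℤ.+ 1 ≡ (ℤ.+ a ℤ.* ℤ.+ 1 ℤ.+ ℤ.+ b ℤ.* ℤ.+ 1) ℤ.* ℤ.+ 1
  cross-multiplied = trans (cong (ℤ._* ℤ.+ 1) (ℤP.pos-+ a b))
    (solve 2 (λ a b → (a :+ b) :* con (ℤ.+ 1) := (a :* con (ℤ.+ 1) :+ b :* con (ℤ.+ 1)) :* con (ℤ.+ 1))
             refl (ℤ.+ a) (ℤ.+ b))
    where open ℤ+*

toℚ-* : ∀ a b → toℚ (a *ℕ b) ≡ toℚ a * toℚ b
toℚ-* a b = ℚP.toℚᵘ-injective (begin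
  toℚᵘ (toℚ (a *ℕ b))                   ≈⟨ toℚᵘ-/ (a *ℕ b) 0 ⟩
  mkℚᵘ (ℤ.+ (a *ℕ b)) 0                 ≈⟨ *≡* (cong (ℤ._* ℤ.+ 1) (ℤP.pos-* a b)) ⟩
  mkℚᵘ (ℤ.+ a) 0 ℚᵘ.* mkℚᵘ (ℤ.+ b) 0    ≈⟨ ℚᵘP.*-cong (ℚᵘP.≃-sym (toℚᵘ-/ a 0)) (ℚᵘP.≃-sym (toℚᵘ-/ b 0)) ⟩
  toℚᵘ (toℚ a) ℚᵘ.* toℚᵘ (toℚ b)        ≈⟨ ℚᵘP.≃-sym (ℚP.toℚᵘ-homo-* (toℚ a) (toℚ b)) ⟩
  toℚᵘ (toℚ a * toℚ b)                  ∎)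
  where open ℚᵘP.≃-Reasoning

toℚ-nonneg : ∀ n → 0ℚ ≤ℚ toℚ n
toℚ-nonneg n = ℚP.nonNegative⁻¹ (toℚ n) {{ℚP.normalize-nonNeg n 1}}

toℚ-mono : ∀ {a b} → a ≤ b → toℚ a ≤ℚ toℚ b
toℚ-mono {a} {b} a≤b = begin
  toℚ a                  ≡⟨ ℚP.+-identityʳ (toℚ a) ⟨
  toℚ a + 0ℚ             ≤⟨ ℚP.+-monoʳ-≤ (toℚ a) (toℚ-nonneg (b ∸ a)) ⟩
  toℚ a + toℚ (b ∸ a)    ≡⟨ toℚ-+ a (b ∸ a) ⟨
  toℚ (a +ℕ (b ∸ a))     ≡⟨ cong toℚ (ℕP.m+[n∸m]≡n a≤b) ⟩
  toℚ b                  ∎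
  where open ℚP.≤-Reasoning

toℚ-Σ< : ∀ M (f : ℕ → ℕ) → toℚ (ℕΣ.Σ< M f) ≡ Σ< M (λ x → toℚ (f x))
toℚ-Σ< zero    f = refl
toℚ-Σ< (suc M) f = trans (toℚ-+ (f 0) _) (cong (toℚ (f 0) +_) (toℚ-Σ< M (λ x → f (suc x))))

-- the parameter 1/(n+1) of the Poisson variable X_{n+1}
param : ℕ → ℚ
param n = ℤ.+ 1 ℚ./ suc n

param-nonneg : ∀ n → 0ℚ ≤ℚ param n
param-nonneg n = ℚP.nonNegative⁻¹ (param n) {{ℚP.normalize-nonNeg 1 (suc n)}}

param≤1 : ∀ n → param n ≤ℚ 1ℚ
param≤1 n = ℚP.toℚᵘ-cancel-≤ (ℚᵘP.≤-respˡ-≃ (ℚᵘP.≃-sym (toℚᵘ-/ 1 n)) (*≤* (ℤ.+≤+ (s≤s z≤n))))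

suc-*-param : ∀ n → toℚ (suc n) * param n ≡ 1ℚ
suc-*-param n = ℚP.toℚᵘ-injective (begin
  toℚᵘ (toℚ (suc n) * param n)              ≈⟨ ℚP.toℚᵘ-homo-* (toℚ (suc n)) (param n) ⟩
  toℚᵘ (toℚ (suc n)) ℚᵘ.* toℚᵘ (param n)    ≈⟨ ℚᵘP.*-cong (toℚᵘ-/ (suc n) 0) (toℚᵘ-/ 1 n) ⟩
  mkℚᵘ (ℤ.+ suc n) 0 ℚᵘ.* mkℚᵘ (ℤ.+ 1) n    ≈⟨ *≡* (cong (λ t → ℤ.+ suc t) cross-multiplied) ⟩
  toℚᵘ 1ℚ                                   ∎)
  where
  open ℚᵘP.≃-Reasoning
  cross-multiplied : (n *ℕ 1) *ℕ 1 ≡ n +ℕ 0 +ℕ 0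
  cross-multiplied = solve 1 (λ n → (n :* con 1) :* con 1 := n :+ con 0 :+ con 0) refl n
    where open ℕ+*

*-monoˡ-≤ : ∀ {r p q} → 0ℚ ≤ℚ r → p ≤ℚ q → r * p ≤ℚ r * q
*-monoˡ-≤ {r} 0≤r = ℚP.*-monoˡ-≤-nonNeg r {{ℚ.nonNegative 0≤r}}

*-monoʳ-≤ : ∀ {r p q} → 0ℚ ≤ℚ r → p ≤ℚ q → p * r ≤ℚ q * r
*-monoʳ-≤ {r} 0≤r = ℚP.*-monoʳ-≤-nonNeg r {{ℚ.nonNegative 0≤r}}

*-nonneg : ∀ {p q} → 0ℚ ≤ℚ p → 0ℚ ≤ℚ q → 0ℚ ≤ℚ p * q
*-nonneg {p} {q} 0≤p 0≤q = subst (_≤ℚ p * q) (ℚP.*-zeroˡ q) (*-monoʳ-≤ 0≤q 0≤p)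

≤1-*-≤ : ∀ {r p} → r ≤ℚ 1ℚ → 0ℚ ≤ℚ p → r * p ≤ℚ p
≤1-*-≤ {r} {p} r≤1 0≤p = subst (r * p ≤ℚ_) (ℚP.*-identityˡ p) (*-monoʳ-≤ 0≤p r≤1)

*-leftComm : ∀ a b c → a * (b * c) ≡ b * (a * c)
*-leftComm = solve 3 (λ a b c → a :* (b :* c) := b :* (a :* c)) refl
  where open ℚ+*

Σ<-mono : ∀ M {f g : ℕ → ℚ} → (∀ x → f x ≤ℚ g x) → Σ< M f ≤ℚ Σ< M g
Σ<-mono zero    f≤g = ℚP.≤-refl
Σ<-mono (suc M) f≤g = ℚP.+-mono-≤ (f≤g 0) (Σ<-mono M (λ x → f≤g (suc x)))

Σ<-nonneg : ∀ M {f : ℕ → ℚ} → (∀ x → 0ℚ ≤ℚ f x) → 0ℚ ≤ℚ Σ< M f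
Σ<-nonneg zero    0≤f = ℚP.≤-refl
Σ<-nonneg (suc M) 0≤f = ℚP.+-mono-≤ (0≤f 0) (Σ<-nonneg M (λ x → 0≤f (suc x)))

Σ<-≤-suc : ∀ M {f : ℕ → ℚ} → (∀ x → 0ℚ ≤ℚ f x) → Σ< M f ≤ℚ Σ< (suc M) f
Σ<-≤-suc zero    0≤f = ℚP.+-mono-≤ (0≤f 0) ℚP.≤-refl
Σ<-≤-suc (suc M) {f} 0≤f = ℚP.+-monoʳ-≤ (f 0) (Σ<-≤-suc M (λ x → 0≤f (suc x)))

-- Truncated expectations over the box {0,…,N}ᵏ
--
-- Up to the normalising factor e^{H_k}, 𝔼 w k N g is the contribution of
-- the box {0,…,N}ᵏ to E g(X_{w+1},…,X_{w+k}).  It is defined coordinate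
-- by coordinate, which exhibits the product structure of the measure.

poisson-nonneg : ∀ w x → 0ℚ ≤ℚ poisNoExp w x
poisson-nonneg w zero    = ℚP.nonNegative⁻¹ 1ℚ
poisson-nonneg w (suc x) = *-nonneg (*-nonneg (poisson-nonneg w x) (param-nonneg w)) (param-nonneg x)

𝔼 : ℕ → (k : ℕ) → ℕ → (Vec ℕ k → ℚ) → ℚ
𝔼 w zero    N g = g []
𝔼 w (suc k) N g = Σ< (suc N) (λ x → poisNoExp w x * 𝔼 (suc w) k N (λ v → g (x ∷ v)))

𝔼-cong : ∀ w k N {f g : Vec ℕ k → ℚ} → (∀ v → f v ≡ g v) → 𝔼 w k N f ≡ 𝔼 w k N g
𝔼-cong w zero    N f≡g = f≡g []
𝔼-cong w (suc k) N f≡g = Σ<-cong (suc N) (λ x →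
  cong (poisNoExp w x *_) (𝔼-cong (suc w) k N (λ v → f≡g (x ∷ v))))

𝔼-mono : ∀ w k N {f g : Vec ℕ k → ℚ} → (∀ v → f v ≤ℚ g v) → 𝔼 w k N f ≤ℚ 𝔼 w k N g
𝔼-mono w zero    N f≤g = f≤g []
𝔼-mono w (suc k) N f≤g = Σ<-mono (suc N) (λ x →
  *-monoˡ-≤ (poisson-nonneg w x) (𝔼-mono (suc w) k N (λ v → f≤g (x ∷ v))))

𝔼-nonneg : ∀ w k N {f : Vec ℕ k → ℚ} → (∀ v → 0ℚ ≤ℚ f v) → 0ℚ ≤ℚ 𝔼 w k N f
𝔼-nonneg w zero    N 0≤f = 0≤f []
𝔼-nonneg w (suc k) N 0≤f = Σ<-nonneg (suc N) (λ x →
  *-nonneg (poisson-nonneg w x) (𝔼-nonneg (suc w) k N (λ v → 0≤f (x ∷ v))))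

𝔼-*ˡ : ∀ w k N (c : ℚ) (f : Vec ℕ k → ℚ) → 𝔼 w k N (λ v → c * f v) ≡ c * 𝔼 w k N f
𝔼-*ˡ w zero    N c f = refl
𝔼-*ˡ w (suc k) N c f = trans
  (Σ<-cong (suc N) (λ x → trans (cong (poisNoExp w x *_) (𝔼-*ˡ (suc w) k N c (λ v → f (x ∷ v))))
                                (*-leftComm (poisNoExp w x) c _)))
  (Σ<-*ˡ (suc N) c (λ x → poisNoExp w x * 𝔼 (suc w) k N (λ v → f (x ∷ v))))

box-𝔼 : ∀ w k N (g : Vec ℕ k → ℚ) →
        Σ∈ (box k N) (λ m → g m * weightFrom w (toList m)) ≡ 𝔼 w k N g
box-𝔼 w zero    N g = trans (ℚP.+-identityʳ _) (ℚP.*-identityʳ (g []))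
box-𝔼 w (suc k) N g = begin
  Σ∈ (concatMap (λ x → map (x ∷_) (box k N)) (upTo (suc N))) G
    ≡⟨ Σ∈-concatMap (λ x → map (x ∷_) (box k N)) (upTo (suc N)) G ⟩
  Σ∈ (upTo (suc N)) (λ x → Σ∈ (map (x ∷_) (box k N)) G)
    ≡⟨ Σ∈-cong (upTo (suc N)) slice ⟩
  Σ∈ (upTo (suc N)) (λ x → poisNoExp w x * 𝔼 (suc w) k N (λ v → g (x ∷ v)))
    ≡⟨ Σ∈-upTo (suc N) (λ x → poisNoExp w x * 𝔼 (suc w) k N (λ v → g (x ∷ v))) ⟩
  𝔼 w (suc k) N g ∎
  where
  open ≡-Reasoning
  G : Vec ℕ (suc k) → ℚ
  G m = g m * weightFrom w (toList m)
  slice : ∀ x → Σ∈ (map (x ∷_) (box k N)) G ≡ poisNoExp w x * 𝔼 (suc w) k N (λ v → g (x ∷ v))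
  slice x = begin
    Σ∈ (map (x ∷_) (box k N)) G
      ≡⟨ Σ∈-map (x ∷_) (box k N) G ⟩
    Σ∈ (box k N) (λ v → g (x ∷ v) * (poisNoExp w x * weightFrom (suc w) (toList v)))
      ≡⟨ Σ∈-cong (box k N) (λ v → *-leftComm (g (x ∷ v)) (poisNoExp w x) _) ⟩
    Σ∈ (box k N) (λ v → poisNoExp w x * (g (x ∷ v) * weightFrom (suc w) (toList v)))
      ≡⟨ Σ∈-*ˡ (box k N) (poisNoExp w x) _ ⟩
    poisNoExp w x * Σ∈ (box k N) (λ v → g (x ∷ v) * weightFrom (suc w) (toList v))
      ≡⟨ cong (poisNoExp w x *_) (box-𝔼 (suc w) k N (λ v → g (x ∷ v))) ⟩
    poisNoExp w x * 𝔼 (suc w) k N (λ v → g (x ∷ v)) ∎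

partialE-𝔼 : ∀ k N (F : Vec ℕ k → ℕ) → partialE k N F ≡ 𝔼 0 k N (λ m → toℚ (F m))
partialE-𝔼 k N F = box-𝔼 0 k N (λ m → toℚ (F m))

_↓_ : ℕ → ℕ → ℕ
x ↓ zero  = 1
x ↓ suc l = x *ℕ (ℕ.pred x ↓ l)

*-↓ : ∀ x l → x *ℕ (x ↓ l) ≡ x ↓ suc l +ℕ l *ℕ (x ↓ l)
*-↓ x       zero    = sym (ℕP.+-identityʳ _)
*-↓ zero    (suc l) = sym (ℕP.*-zeroʳ (suc l))
*-↓ (suc y) (suc l) = begin
  suc y *ℕ (suc y *ℕ (y ↓ l))
    ≡⟨ solve 2 (λ y F → (con 1 :+ y) :* ((con 1 :+ y) :* F)
                     := (con 1 :+ y) :* (y :* F) :+ (con 1 :+ y) :* F) refl y (y ↓ l) ⟩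
  suc y *ℕ (y *ℕ (y ↓ l)) +ℕ suc y *ℕ (y ↓ l)
    ≡⟨ cong (λ t → suc y *ℕ t +ℕ suc y *ℕ (y ↓ l)) (*-↓ y l) ⟩
  suc y *ℕ (y ↓ suc l +ℕ l *ℕ (y ↓ l)) +ℕ suc y *ℕ (y ↓ l)
    ≡⟨ solve 4 (λ y l F G → (con 1 :+ y) :* (G :+ l :* F) :+ (con 1 :+ y) :* F
                         := (con 1 :+ y) :* G :+ (con 1 :+ l) :* ((con 1 :+ y) :* F))
               refl y l (y ↓ l) (y ↓ suc l) ⟩
  suc y *ℕ (y ↓ suc l) +ℕ suc l *ℕ (suc y *ℕ (y ↓ l)) ∎
  where
  open ≡-Reasoning
  open ℕ+*

stirling2-vanishes : ∀ a l → a < l → stirling2 a l ≡ 0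
stirling2-vanishes zero    (suc l) _         = refl
stirling2-vanishes (suc a) (suc l) (s≤s a<l) = trans
  (cong₂ (λ s t → suc l *ℕ s +ℕ t) (stirling2-vanishes a (suc l) (ℕP.m<n⇒m<1+n a<l))
                                   (stirling2-vanishes a l a<l))
  (cong (_+ℕ 0) (ℕP.*-zeroʳ l))

stirling-expansion : ∀ a L x → a < L → x ^ a ≡ ℕΣ.Σ< L (λ l → stirling2 a l *ℕ (x ↓ l))
stirling-expansion zero    (suc L) x _         = cong suc (sym (ℕΣ.Σ<-zero L))
stirling-expansion (suc a) (suc L) x (s≤s a<L) = begin
  x *ℕ x ^ a
    ≡⟨ cong (x *ℕ_) (stirling-expansion a (suc L) x (ℕP.m<n⇒m<1+n a<L)) ⟩
  x *ℕ ℕΣ.Σ< (suc L) (λ l → S a l *ℕ (x ↓ l))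
    ≡⟨ ℕΣ.Σ<-*ˡ (suc L) x (λ l → S a l *ℕ (x ↓ l)) ⟨
  ℕΣ.Σ< (suc L) (λ l → x *ℕ (S a l *ℕ (x ↓ l)))
    ≡⟨ ℕΣ.Σ<-cong (suc L) raise ⟩
  ℕΣ.Σ< (suc L) (λ l → up l +ℕ down l)
    ≡⟨ ℕΣ.Σ<-+ (suc L) up down ⟩
  ℕΣ.Σ< (suc L) up +ℕ ℕΣ.Σ< L (λ l → down (suc l))
    ≡⟨ cong (_+ℕ ℕΣ.Σ< L (λ l → down (suc l))) drop-last ⟩
  ℕΣ.Σ< L up +ℕ ℕΣ.Σ< L (λ l → down (suc l))
    ≡⟨ ℕΣ.Σ<-+ L up (λ l → down (suc l)) ⟨
  ℕΣ.Σ< L (λ l → up l +ℕ down (suc l))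
    ≡⟨ ℕΣ.Σ<-cong L recurrence ⟩
  ℕΣ.Σ< (suc L) (λ l → S (suc a) l *ℕ (x ↓ l)) ∎
  where
  open ≡-Reasoning
  open ℕ+*
  S = stirling2
  up down : ℕ → ℕ
  up   l = S a l *ℕ (x ↓ suc l)
  down l = l *ℕ (S a l *ℕ (x ↓ l))
  raise : ∀ l → x *ℕ (S a l *ℕ (x ↓ l)) ≡ up l +ℕ down l
  raise l = begin
    x *ℕ (S a l *ℕ (x ↓ l))
      ≡⟨ solve 3 (λ x s f → x :* (s :* f) := s :* (x :* f)) refl x (S a l) (x ↓ l) ⟩
    S a l *ℕ (x *ℕ (x ↓ l))
      ≡⟨ cong (S a l *ℕ_) (*-↓ x l) ⟩
    S a l *ℕ (x ↓ suc l +ℕ l *ℕ (x ↓ l))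
      ≡⟨ solve 4 (λ s g l f → s :* (g :+ l :* f) := s :* g :+ l :* (s :* f)) refl (S a l) (x ↓ suc l) l (x ↓ l) ⟩
    up l +ℕ down l ∎
  -- the top term carries S(a, L) = 0
  drop-last : ℕΣ.Σ< (suc L) up ≡ ℕΣ.Σ< L up
  drop-last = begin
    ℕΣ.Σ< (suc L) up                     ≡⟨ ℕΣ.Σ<-last L up ⟩
    ℕΣ.Σ< L up +ℕ S a L *ℕ (x ↓ suc L)
                                         ≡⟨ cong (λ s → ℕΣ.Σ< L up +ℕ s *ℕ (x ↓ suc L)) (stirling2-vanishes a L a<L) ⟩
    ℕΣ.Σ< L up +ℕ 0                       ≡⟨ ℕP.+-identityʳ _ ⟩
    ℕΣ.Σ< L up                           ∎
  -- the recurrence S(a+1, l+1) = (l+1) S(a, l+1) + S(a, l)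
  recurrence : ∀ l → up l +ℕ down (suc l) ≡ S (suc a) (suc l) *ℕ (x ↓ suc l)
  recurrence l = solve 4 (λ s₀ s₁ l X → s₀ :* X :+ (con 1 :+ l) :* (s₁ :* X)
                                    := ((con 1 :+ l) :* s₁ :+ s₀) :* X)
                         refl (S a l) (S a (suc l)) l (x ↓ suc l)

-- Truncated moments of a Poisson variable
--
-- Here p = poisNoExp w is the unnormalised law of a Poisson variable with
-- parameter λ = param w, and all sums run over an initial segment
-- {0,…,M-1}.  The identity (x+1) p(x+1) = λ p(x) lowers the range by one,
-- which is why every bound below survives truncation.

poisson-step : ∀ w x → toℚ (suc x) * poisNoExp w (suc x) ≡ param w * poisNoExp w x
poisson-step w x = begin
  toℚ (suc x) * ((P * param w) * param x)
    ≡⟨ solve 4 (λ s P l m → s :* ((P :* l) :* m) := (l :* P) :* (s :* m)) refl (toℚ (suc x)) P (param w) (param x) ⟩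
  (param w * P) * (toℚ (suc x) * param x)   ≡⟨ cong ((param w * P) *_) (suc-*-param x) ⟩
  (param w * P) * 1ℚ                        ≡⟨ ℚP.*-identityʳ _ ⟩
  param w * P                               ∎
  where
  open ≡-Reasoning
  open ℚ+*
  P = poisNoExp w x

factorial-moment-shift : ∀ w l M →
  Σ< (suc M) (λ x → toℚ (x ↓ suc l) * poisNoExp w x) ≡ param w * Σ< M (λ x → toℚ (x ↓ l) * poisNoExp w x)
factorial-moment-shift w l M = begin
  toℚ 0 * p 0 + Σ< M (λ x → toℚ (suc x *ℕ (x ↓ l)) * p (suc x))
    ≡⟨ cong₂ _+_ (ℚP.*-zeroˡ (p 0)) (Σ<-cong M shift) ⟩
  0ℚ + Σ< M (λ x → param w * (toℚ (x ↓ l) * p x))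
    ≡⟨ ℚP.+-identityˡ _ ⟩
  Σ< M (λ x → param w * (toℚ (x ↓ l) * p x))
    ≡⟨ Σ<-*ˡ M (param w) (λ x → toℚ (x ↓ l) * p x) ⟩
  param w * Σ< M (λ x → toℚ (x ↓ l) * p x) ∎
  where
  open ≡-Reasoning
  p = poisNoExp w
  shift : ∀ x → toℚ (suc x *ℕ (x ↓ l)) * p (suc x) ≡ param w * (toℚ (x ↓ l) * p x)
  shift x = begin
    toℚ (suc x *ℕ (x ↓ l)) * p (suc x)       ≡⟨ cong (_* p (suc x)) (toℚ-* (suc x) (x ↓ l)) ⟩
    (toℚ (suc x) * toℚ (x ↓ l)) * p (suc x)  ≡⟨ cong (_* p (suc x)) (ℚP.*-comm (toℚ (suc x)) (toℚ (x ↓ l))) ⟩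
    (toℚ (x ↓ l) * toℚ (suc x)) * p (suc x)  ≡⟨ ℚP.*-assoc (toℚ (x ↓ l)) (toℚ (suc x)) (p (suc x)) ⟩
    toℚ (x ↓ l) * (toℚ (suc x) * p (suc x))  ≡⟨ cong (toℚ (x ↓ l) *_) (poisson-step w x) ⟩
    toℚ (x ↓ l) * (param w * p x)            ≡⟨ *-leftComm (toℚ (x ↓ l)) (param w) (p x) ⟩
    param w * (toℚ (x ↓ l) * p x)            ∎

factorial-moment-≤-mass : ∀ w l M →
  Σ< M (λ x → toℚ (x ↓ l) * poisNoExp w x) ≤ℚ Σ< M (poisNoExp w)
factorial-moment-≤-mass w zero    M       = ℚP.≤-reflexive (Σ<-cong M (λ x → ℚP.*-identityˡ (poisNoExp w x)))
factorial-moment-≤-mass w (suc l) zero    = ℚP.≤-refl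
factorial-moment-≤-mass w (suc l) (suc M) = begin
  Σ< (suc M) (λ x → toℚ (x ↓ suc l) * poisNoExp w x)   ≡⟨ factorial-moment-shift w l M ⟩
  param w * Σ< M (λ x → toℚ (x ↓ l) * poisNoExp w x)   ≤⟨ *-monoˡ-≤ (param-nonneg w) (factorial-moment-≤-mass w l M) ⟩
  param w * Σ< M (poisNoExp w)                         ≤⟨ ≤1-*-≤ (param≤1 w) (Σ<-nonneg M (poisson-nonneg w)) ⟩
  Σ< M (poisNoExp w)                                   ≤⟨ Σ<-≤-suc M (poisson-nonneg w) ⟩
  Σ< (suc M) (poisNoExp w)                             ∎
  where open ℚP.≤-Reasoning

factorial-moment-bound : ∀ w l M →
  Σ< M (λ x → toℚ (x ↓ suc l) * poisNoExp w x) ≤ℚ param w * Σ< M (poisNoExp w)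
factorial-moment-bound w l zero    = ℚP.≤-reflexive (sym (ℚP.*-zeroʳ (param w)))
factorial-moment-bound w l (suc M) = begin
  Σ< (suc M) (λ x → toℚ (x ↓ suc l) * poisNoExp w x)   ≡⟨ factorial-moment-shift w l M ⟩
  param w * Σ< M (λ x → toℚ (x ↓ l) * poisNoExp w x)   ≤⟨ *-monoˡ-≤ (param-nonneg w) (factorial-moment-≤-mass w l M) ⟩
  param w * Σ< M (poisNoExp w)                         ≤⟨ *-monoˡ-≤ (param-nonneg w) (Σ<-≤-suc M (poisson-nonneg w)) ⟩
  param w * Σ< (suc M) (poisNoExp w)                   ∎
  where open ℚP.≤-Reasoning

-- E X^a ≤ B_a λ for a ≥ 1 (truncated): expand x^a into falling factorials;
-- the order-0 term has S(a,0) = 0 and the others are bounded as above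
moment-bound : ∀ w a M →
  Σ< M (λ x → toℚ (x ^ suc a) * poisNoExp w x) ≤ℚ (toℚ (bell (suc a)) * param w) * Σ< M (poisNoExp w)
moment-bound w a M = begin
  Σ< M (λ x → toℚ (x ^ A) * p x)
    ≡⟨ Σ<-cong M expand ⟩
  Σ< M (λ x → Σ< L (λ l → toℚ (S A l) * (toℚ (x ↓ l) * p x)))
    ≡⟨ Σ<-swap M L (λ x l → toℚ (S A l) * (toℚ (x ↓ l) * p x)) ⟩
  Σ< L (λ l → Σ< M (λ x → toℚ (S A l) * (toℚ (x ↓ l) * p x)))
    ≡⟨ Σ<-cong L (λ l → Σ<-*ˡ M (toℚ (S A l)) (λ x → toℚ (x ↓ l) * p x)) ⟩
  Σ< L (λ l → toℚ (S A l) * Σ< M (λ x → toℚ (x ↓ l) * p x))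
    ≤⟨ Σ<-mono L term-bound ⟩
  Σ< L (λ l → toℚ (S A l) * (param w * P))
    ≡⟨ Σ<-*ʳ L (param w * P) (λ l → toℚ (S A l)) ⟩
  Σ< L (λ l → toℚ (S A l)) * (param w * P)
    ≡⟨ cong (_* (param w * P)) (trans (cong toℚ bell-as-sum) (toℚ-Σ< L (S A))) ⟨
  toℚ (bell A) * (param w * P)
    ≡⟨ ℚP.*-assoc (toℚ (bell A)) (param w) P ⟨
  (toℚ (bell A) * param w) * P ∎
  where
  open ℚP.≤-Reasoning
  A = suc a
  L = suc A
  S = stirling2
  p = poisNoExp w
  P = Σ< M p
  bell-as-sum : bell A ≡ ℕΣ.Σ< L (S A)
  bell-as-sum = ℕΣ.Σ∈-upTo L (S A)
  expand : ∀ x → toℚ (x ^ A) * p x ≡ Σ< L (λ l → toℚ (S A l) * (toℚ (x ↓ l) * p x))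
  expand x = begin-equality
    toℚ (x ^ A) * p x
      ≡⟨ cong (λ n → toℚ n * p x) (stirling-expansion A L x (ℕP.n<1+n A)) ⟩
    toℚ (ℕΣ.Σ< L (λ l → S A l *ℕ (x ↓ l))) * p x
      ≡⟨ cong (_* p x) (toℚ-Σ< L (λ l → S A l *ℕ (x ↓ l))) ⟩
    Σ< L (λ l → toℚ (S A l *ℕ (x ↓ l))) * p x
      ≡⟨ Σ<-*ʳ L (p x) (λ l → toℚ (S A l *ℕ (x ↓ l))) ⟨
    Σ< L (λ l → toℚ (S A l *ℕ (x ↓ l)) * p x)
      ≡⟨ Σ<-cong L (λ l → trans (cong (_* p x) (toℚ-* (S A l) (x ↓ l))) (ℚP.*-assoc (toℚ (S A l)) _ (p x))) ⟩
    Σ< L (λ l → toℚ (S A l) * (toℚ (x ↓ l) * p x)) ∎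
  term-bound : ∀ l → toℚ (S A l) * Σ< M (λ x → toℚ (x ↓ l) * p x) ≤ℚ toℚ (S A l) * (param w * P)
  -- the order-0 term vanishes because S(a, 0) = 0 for a ≥ 1
  term-bound zero    = ℚP.≤-reflexive
    (trans (ℚP.*-zeroˡ (Σ< M (λ x → toℚ (x ↓ 0) * p x))) (sym (ℚP.*-zeroˡ (param w * P))))
  term-bound (suc l) = *-monoˡ-≤ (toℚ-nonneg (S A (suc l))) (factorial-moment-bound w l M)

poisson-bound : ∀ w a M →
  Σ< M (λ x → toℚ (x ^ suc a *ℕ suc x) * poisNoExp w x)
    ≤ℚ (toℚ (bell (suc a) +ℕ bell (suc (suc a))) * param w) * Σ< M (poisNoExp w)
poisson-bound w a M = begin
  Σ< M (λ x → toℚ (x ^ A *ℕ suc x) * p x)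
    ≡⟨ Σ<-cong M split ⟩
  Σ< M (λ x → toℚ (x ^ A) * p x + toℚ (x ^ suc A) * p x)
    ≡⟨ Σ<-+ M (λ x → toℚ (x ^ A) * p x) (λ x → toℚ (x ^ suc A) * p x) ⟩
  Σ< M (λ x → toℚ (x ^ A) * p x) + Σ< M (λ x → toℚ (x ^ suc A) * p x)
    ≤⟨ ℚP.+-mono-≤ (moment-bound w a M) (moment-bound w A M) ⟩
  (toℚ (bell A) * param w) * P + (toℚ (bell (suc A)) * param w) * P
    ≡⟨ solve 4 (λ a b l P → (a :* l) :* P :+ (b :* l) :* P := ((a :+ b) :* l) :* P)
               refl (toℚ (bell A)) (toℚ (bell (suc A))) (param w) P ⟩
  ((toℚ (bell A) + toℚ (bell (suc A))) * param w) * P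
    ≡⟨ cong (λ t → (t * param w) * P) (toℚ-+ (bell A) (bell (suc A))) ⟨
  (toℚ (bell A +ℕ bell (suc A)) * param w) * P ∎
  where
  open ℚP.≤-Reasoning
  open ℚ+*
  A = suc a
  p = poisNoExp w
  P = Σ< M p
  split : ∀ x → toℚ (x ^ A *ℕ suc x) * p x ≡ toℚ (x ^ A) * p x + toℚ (x ^ suc A) * p x
  split x = begin-equality
    toℚ (x ^ A *ℕ suc x) * p x                ≡⟨ cong (λ n → toℚ n * p x) x^A*[1+x] ⟩
    toℚ (x ^ A +ℕ x ^ suc A) * p x            ≡⟨ cong (_* p x) (toℚ-+ (x ^ A) (x ^ suc A)) ⟩
    (toℚ (x ^ A) + toℚ (x ^ suc A)) * p x     ≡⟨ ℚP.*-distribʳ-+ (p x) (toℚ (x ^ A)) (toℚ (x ^ suc A)) ⟩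
    toℚ (x ^ A) * p x + toℚ (x ^ suc A) * p x ∎
    where
    x^A*[1+x] : x ^ A *ℕ suc x ≡ x ^ A +ℕ x ^ suc A
    x^A*[1+x] = trans (ℕP.*-suc (x ^ A) x) (cong (x ^ A +ℕ_) (ℕP.*-comm (x ^ A) x))

-- The size of 𝓛 when one coordinate is switched off
--
-- Write m⁰ = m [ i ]≔ 0.  Every element of 𝓛(m⁰) lies in 𝓛(m), and every
-- element of 𝓛(m) is s + y (i+1) with s ∈ 𝓛(m⁰) and y ≤ m_i; since 𝓛 is
-- duplicate-free this gives  |𝓛(m⁰)| ≤ |𝓛(m)| ≤ (m_i + 1) |𝓛(m⁰)|.

∈-─ : {A : Set} {x z : A} {ys : List A} (x∈ys : x ∈ ys) → z ∈ ys → z ≢ x → z ∈ (ys ─ x∈ys)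
∈-─ (here refl) (here refl) z≢x = ⊥-elim (z≢x refl)
∈-─ (here _)    (there z∈) _    = z∈
∈-─ (there _)   (here refl) _   = here refl
∈-─ (there x∈)  (there z∈) z≢x  = there (∈-─ x∈ z∈ z≢x)

unique-⊆-length : {A : Set} {xs ys : List A} → Unique xs → (∀ {z} → z ∈ xs → z ∈ ys) →
                  length xs ≤ length ys
unique-⊆-length {xs = []}     _            _     = z≤n
unique-⊆-length {xs = x ∷ xs} {ys} (x∉xs ∷ u) xs⊆ys = begin
  suc (length xs)            ≤⟨ s≤s (unique-⊆-length u (λ z∈ → ∈-─ x∈ys (xs⊆ys (there z∈)) (All.lookup x∉xs z∈ ∘ sym))) ⟩
  suc (length (ys ─ x∈ys))   ≡⟨ length-removeAt′ ys (Any.index x∈ys) ⟨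
  length ys                  ∎
  where
  open ℕP.≤-Reasoning
  x∈ys = xs⊆ys (here refl)

length-cartesianProductWith : {A B C : Set} (f : A → B → C) (xs : List A) (ys : List B) →
  length (cartesianProductWith f xs ys) ≡ length xs *ℕ length ys
length-cartesianProductWith f []       ys = refl
length-cartesianProductWith f (x ∷ xs) ys = trans (length-++ (map (f x) ys))
  (cong₂ _+ℕ_ (length-map (f x) ys) (length-cartesianProductWith f xs ys))

sums⁻ : ∀ {w c cs z} → z ∈ sumsFrom w (c ∷ cs) →
        ∃ λ m → m ≤ c × ∃ λ s → s ∈ sumsFrom (suc w) cs × z ≡ m *ℕ w +ℕ s
sums⁻ {w} {c} {cs} z∈ with find (∈-concatMap⁻ (λ m → map (λ s → m *ℕ w +ℕ s) (sumsFrom (suc w) cs)) {xs = upTo (suc c)} z∈)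
... | m , m∈ , z∈m with ∈-map⁻ (λ s → m *ℕ w +ℕ s) z∈m
... | s , s∈ , z≡ = m , ℕP.≤-pred (∈-upTo⁻ m∈) , s , s∈ , z≡

sums⁺ : ∀ {w c cs m s} → m ≤ c → s ∈ sumsFrom (suc w) cs → m *ℕ w +ℕ s ∈ sumsFrom w (c ∷ cs)
sums⁺ {w} {c} {cs} {m} {s} m≤c s∈ = ∈-concatMap⁺ (λ m → map (λ s → m *ℕ w +ℕ s) (sumsFrom (suc w) cs))
  (Any.map (λ { refl → ∈-map⁺ (λ s → m *ℕ w +ℕ s) s∈ }) (∈-upTo⁺ (s≤s m≤c)))

sums-switch-off : ∀ {k} w (v : Vec ℕ k) (i : Fin k) {z} →
  z ∈ sumsFrom w (toList (v [ i ]≔ 0)) → z ∈ sumsFrom w (toList v)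
sums-switch-off w (c ∷ v) fzero z∈ with sums⁻ {w} {0} {toList v} z∈
... | .0 , z≤n , s , s∈ , refl = sums⁺ {w} {c} {toList v} {0} z≤n s∈
sums-switch-off w (c ∷ v) (fsuc i) z∈ with sums⁻ {w} {c} {toList (v [ i ]≔ 0)} z∈
... | m , m≤c , s , s∈ , refl = sums⁺ {w} {c} {toList v} m≤c (sums-switch-off (suc w) v i s∈)

sums-split : ∀ {k} w (v : Vec ℕ k) (i : Fin k) {z} → z ∈ sumsFrom w (toList v) →
  ∃ λ y → y ≤ lookup v i × ∃ λ s → s ∈ sumsFrom w (toList (v [ i ]≔ 0)) × z ≡ s +ℕ y *ℕ (w +ℕ toℕ i)
sums-split w (c ∷ v) fzero z∈ with sums⁻ {w} {c} {toList v} z∈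
... | m , m≤c , s , s∈ , refl = m , m≤c , s , sums⁺ {w} {0} {toList v} z≤n s∈ ,
  trans (ℕP.+-comm (m *ℕ w) s) (cong (λ t → s +ℕ m *ℕ t) (sym (ℕP.+-identityʳ w)))
sums-split w (c ∷ v) (fsuc i) z∈ with sums⁻ {w} {c} {toList v} z∈
... | m , m≤c , s , s∈ , refl with sums-split (suc w) v i s∈
... | y , y≤ , s′ , s′∈ , refl = y , y≤ , m *ℕ w +ℕ s′ , sums⁺ {w} {c} {toList (v [ i ]≔ 0)} m≤c s′∈ ,
  trans (sym (ℕP.+-assoc (m *ℕ w) s′ _)) (cong (λ t → m *ℕ w +ℕ s′ +ℕ y *ℕ t) (sym (ℕP.+-suc w (toℕ i))))

card𝓛-switch-off-≤ : ∀ {k} (v : Vec ℕ k) (i : Fin k) → card𝓛 (v [ i ]≔ 0) ≤ card𝓛 v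
card𝓛-switch-off-≤ v i = unique-⊆-length (deduplicate-! ℕ._≟_ _)
  (λ z∈ → ∈-deduplicate⁺ ℕ._≟_ (sums-switch-off 1 v i (∈-deduplicate⁻ ℕ._≟_ _ z∈)))

-- |𝓛(m)| ≤ (m_i + 1) |𝓛(m⁰)|: 𝓛(m) lies in the list of all s + y (i+1), y ≤ m_i, s ∈ 𝓛(m⁰)
card𝓛-≤-switch-off : ∀ {k} (v : Vec ℕ k) (i : Fin k) → card𝓛 v ≤ suc (lookup v i) *ℕ card𝓛 (v [ i ]≔ 0)
card𝓛-≤-switch-off v i = begin
  card𝓛 v            ≤⟨ unique-⊆-length (deduplicate-! ℕ._≟_ _) covered ⟩
  length candidates  ≡⟨ length-cartesianProductWith shifted (upTo (suc (lookup v i))) 𝓛⁰ ⟩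
  length (upTo (suc (lookup v i))) *ℕ card𝓛 (v [ i ]≔ 0)
                     ≡⟨ cong (_*ℕ card𝓛 (v [ i ]≔ 0)) (length-upTo (suc (lookup v i))) ⟩
  suc (lookup v i) *ℕ card𝓛 (v [ i ]≔ 0) ∎
  where
  open ℕP.≤-Reasoning
  𝓛⁰ = 𝓛 (v [ i ]≔ 0)
  shifted : ℕ → ℕ → ℕ
  shifted y s = s +ℕ y *ℕ suc (toℕ i)
  candidates = cartesianProductWith shifted (upTo (suc (lookup v i))) 𝓛⁰
  covered : ∀ {z} → z ∈ 𝓛 v → z ∈ candidates
  covered z∈ with sums-split 1 v i (∈-deduplicate⁻ ℕ._≟_ _ z∈)
  ... | y , y≤ , s , s∈ , refl =
    ∈-cartesianProductWith⁺ shifted (∈-upTo⁺ (s≤s y≤)) (∈-deduplicate⁺ ℕ._≟_ s∈)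

IndependentOf : ∀ {A : Set} {k} → Fin k → (Vec ℕ k → A) → Set
IndependentOf i G = ∀ m y → G (m [ i ]≔ y) ≡ G m

OneDimBound : ℕ → ℕ → (ℕ → ℚ) → ℚ → Set
OneDimBound n N f c = Σ< (suc N) (λ x → f x * poisNoExp n x) ≤ℚ c * Σ< (suc N) (poisNoExp n)

factor-coordinate : ∀ {k} w (i : Fin k) N (G : Vec ℕ k → ℚ) → (∀ m → 0ℚ ≤ℚ G m) → IndependentOf i G →
  (f : ℕ → ℚ) (c : ℚ) → OneDimBound (w +ℕ toℕ i) N f c →
  𝔼 w k N (λ m → G m * f (lookup m i)) ≤ℚ c * 𝔼 w k N G
factor-coordinate {suc k} w fzero N G 0≤G G-indep f c bound = begin
  Σ< (suc N) (λ x → p x * 𝔼 (suc w) k N (λ v → G (x ∷ v) * f x))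
    ≡⟨ Σ<-cong (suc N) pull-out ⟩
  Σ< (suc N) (λ x → (f x * p x) * E₀)
    ≡⟨ Σ<-*ʳ (suc N) E₀ (λ x → f x * p x) ⟩
  Σ< (suc N) (λ x → f x * p x) * E₀
    ≤⟨ *-monoʳ-≤ (𝔼-nonneg (suc w) k N (λ v → 0≤G (0 ∷ v)))
                 (subst (λ n → OneDimBound n N f c) (ℕP.+-identityʳ w) bound) ⟩
  (c * Σ< (suc N) p) * E₀
    ≡⟨ ℚP.*-assoc c (Σ< (suc N) p) E₀ ⟩
  c * (Σ< (suc N) p * E₀)
    ≡⟨ cong (c *_) (Σ<-*ʳ (suc N) E₀ p) ⟨
  c * Σ< (suc N) (λ x → p x * E₀)
    ≡⟨ cong (c *_) (Σ<-cong (suc N) (λ x → cong (p x *_) (𝔼-cong (suc w) k N (λ v → sym (G-indep (0 ∷ v) x))))) ⟩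
  c * 𝔼 w (suc k) N G ∎
  where
  open ℚP.≤-Reasoning
  p = poisNoExp w
  -- on the slice {m₀ = x} the integrand is f x times G on the slice {m₀ = 0}
  E₀ = 𝔼 (suc w) k N (λ v → G (0 ∷ v))
  pull-out : ∀ x → p x * 𝔼 (suc w) k N (λ v → G (x ∷ v) * f x) ≡ (f x * p x) * E₀
  pull-out x = begin-equality
    p x * 𝔼 (suc w) k N (λ v → G (x ∷ v) * f x)
      ≡⟨ cong (p x *_) (𝔼-cong (suc w) k N (λ v → trans (cong (_* f x) (G-indep (0 ∷ v) x)) (ℚP.*-comm (G (0 ∷ v)) (f x)))) ⟩
    p x * 𝔼 (suc w) k N (λ v → f x * G (0 ∷ v))
      ≡⟨ cong (p x *_) (𝔼-*ˡ (suc w) k N (f x) (λ v → G (0 ∷ v))) ⟩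
    p x * (f x * E₀)
      ≡⟨ trans (*-leftComm (p x) (f x) E₀) (sym (ℚP.*-assoc (f x) (p x) E₀)) ⟩
    (f x * p x) * E₀ ∎
factor-coordinate {suc k} w (fsuc i) N G 0≤G G-indep f c bound = begin
  Σ< (suc N) (λ x → p x * 𝔼 (suc w) k N (λ v → G (x ∷ v) * f (lookup v i)))
    ≤⟨ Σ<-mono (suc N) (λ x → *-monoˡ-≤ (poisson-nonneg w x) (slice-bound x)) ⟩
  Σ< (suc N) (λ x → p x * (c * 𝔼 (suc w) k N (λ v → G (x ∷ v))))
    ≡⟨ Σ<-cong (suc N) (λ x → *-leftComm (p x) c (𝔼 (suc w) k N (λ v → G (x ∷ v)))) ⟩
  Σ< (suc N) (λ x → c * (p x * 𝔼 (suc w) k N (λ v → G (x ∷ v))))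
    ≡⟨ Σ<-*ˡ (suc N) c (λ x → p x * 𝔼 (suc w) k N (λ v → G (x ∷ v))) ⟩
  c * 𝔼 w (suc k) N G ∎
  where
  open ℚP.≤-Reasoning
  p = poisNoExp w
  slice-bound : ∀ x → 𝔼 (suc w) k N (λ v → G (x ∷ v) * f (lookup v i)) ≤ℚ c * 𝔼 (suc w) k N (λ v → G (x ∷ v))
  slice-bound x = factor-coordinate (suc w) i N (λ v → G (x ∷ v)) (λ v → 0≤G (x ∷ v)) (λ v y → G-indep (x ∷ v) y)
    f c (subst (λ n → OneDimBound n N f c) (ℕP.+-suc w (toℕ i)) bound)

-- Bound |𝓛(m)| by (m_i+1) |𝓛(m⁰)|, factor out coordinate i using the
-- Poisson estimate, and return via |𝓛(m⁰)| ≤ |𝓛(m)|.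
one-factor : ∀ {k} N (i : Fin k) (b : ℕ) → 1 ≤ b → (χ : Vec ℕ k → ℕ) → IndependentOf i χ →
  𝔼 0 k N (λ m → toℚ (card𝓛 m *ℕ (lookup m i ^ b *ℕ χ m)))
    ≤ℚ (toℚ (bell b +ℕ bell (suc b)) * param (toℕ i)) * 𝔼 0 k N (λ m → toℚ (card𝓛 m *ℕ χ m))
one-factor {k} N i (suc a) (s≤s z≤n) χ χ-indep = begin
  𝔼 0 k N (λ m → toℚ (card𝓛 m *ℕ (lookup m i ^ b *ℕ χ m)))
    ≤⟨ 𝔼-mono 0 k N upper ⟩
  𝔼 0 k N (λ m → G m * toℚ (f (lookup m i)))
    ≤⟨ factor-coordinate 0 i N G (λ m → toℚ-nonneg (card𝓛 (m [ i ]≔ 0) *ℕ χ m)) G-indep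
                         (λ x → toℚ (f x)) c (poisson-bound (toℕ i) a (suc N)) ⟩
  c * 𝔼 0 k N G
    ≤⟨ *-monoˡ-≤ c-nonneg (𝔼-mono 0 k N (λ m → toℚ-mono (ℕP.*-monoˡ-≤ (χ m) (card𝓛-switch-off-≤ m i)))) ⟩
  c * 𝔼 0 k N (λ m → toℚ (card𝓛 m *ℕ χ m)) ∎
  where
  open ℚP.≤-Reasoning
  b = suc a
  c = toℚ (bell b +ℕ bell (suc b)) * param (toℕ i)
  c-nonneg : 0ℚ ≤ℚ c
  c-nonneg = *-nonneg (toℚ-nonneg (bell b +ℕ bell (suc b))) (param-nonneg (toℕ i))
  f : ℕ → ℕ
  f x = x ^ b *ℕ suc x
  G : Vec ℕ k → ℚ
  G m = toℚ (card𝓛 (m [ i ]≔ 0) *ℕ χ m)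
  G-indep : IndependentOf i G
  G-indep m y = cong toℚ (cong₂ _*ℕ_ (cong card𝓛 ([]≔-idempotent m i)) (χ-indep m y))
  upper : ∀ m → toℚ (card𝓛 m *ℕ (lookup m i ^ b *ℕ χ m)) ≤ℚ G m * toℚ (f (lookup m i))
  upper m = subst (toℚ (card𝓛 m *ℕ (x ^ b *ℕ χ m)) ≤ℚ_) (toℚ-* (card𝓛 (m [ i ]≔ 0) *ℕ χ m) (f x))
    (toℚ-mono (ℕP.≤-trans (ℕP.*-monoˡ-≤ (x ^ b *ℕ χ m) (card𝓛-≤-switch-off m i))
      (ℕP.≤-reflexive (solve 4 (λ x L y z → ((con 1 :+ x) :* L) :* (y :* z) := (L :* z) :* (y :* (con 1 :+ x)))
                        refl x (card𝓛 (m [ i ]≔ 0)) (x ^ b) (χ m)))))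
    where
    open ℕ+*
    x = lookup m i

monomial-ignores : ∀ {k h} (j : Fin h → Fin k) (a : Fin h → ℕ) (i : Fin k) → (∀ t → j t ≢ i) →
                   IndependentOf i (monomial j a)
monomial-ignores {h = zero}  j a i j≢i m y = refl
monomial-ignores {h = suc h} j a i j≢i m y = cong₂ _*ℕ_
  (cong (_^ a fzero) (lookup∘update′ (j≢i fzero) m y))
  (monomial-ignores (j ∘ fsuc) (a ∘ fsuc) i (j≢i ∘ fsuc) m y)

truncated-bound : ∀ k N h (j : Fin h → Fin k) → Injective _≡_ _≡_ j → (a : Fin h → ℕ) → (∀ t → 1 ≤ a t) →
  𝔼 0 k N (λ m → toℚ (card𝓛 m *ℕ monomial j a m))
    ≤ℚ (toℚ (constC h a) * invProdJ j) * 𝔼 0 k N (λ m → toℚ (card𝓛 m))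
truncated-bound k N zero    _ _     _ _   = ℚP.≤-reflexive
  (trans (𝔼-cong 0 k N (λ m → cong toℚ (ℕP.*-identityʳ (card𝓛 m)))) (sym (ℚP.*-identityˡ _)))
truncated-bound k N (suc h) j j-inj a a≥1 = begin
  𝔼 0 k N (λ m → toℚ (card𝓛 m *ℕ (lookup m (j fzero) ^ a fzero *ℕ χ m)))
    ≤⟨ one-factor N (j fzero) (a fzero) (a≥1 fzero) χ
         (monomial-ignores (j ∘ fsuc) (a ∘ fsuc) (j fzero) (λ t → 0≢1+n ∘ sym ∘ j-inj)) ⟩
  (B * λ₀) * 𝔼 0 k N (λ m → toℚ (card𝓛 m *ℕ χ m))
    ≤⟨ *-monoˡ-≤ (*-nonneg (toℚ-nonneg b₀) (param-nonneg (toℕ (j fzero))))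
         (truncated-bound k N h (j ∘ fsuc) (suc-injective ∘ j-inj) (a ∘ fsuc) (a≥1 ∘ fsuc)) ⟩
  (B * λ₀) * ((toℚ (constC h (a ∘ fsuc)) * invProdJ (j ∘ fsuc)) * E)
    ≡⟨ solve 5 (λ B l C I E → (B :* l) :* ((C :* I) :* E) := ((B :* C) :* (l :* I)) :* E)
               refl B λ₀ (toℚ (constC h (a ∘ fsuc))) (invProdJ (j ∘ fsuc)) E ⟩
  ((B * toℚ (constC h (a ∘ fsuc))) * (λ₀ * invProdJ (j ∘ fsuc))) * E
    ≡⟨ cong (λ t → (t * (λ₀ * invProdJ (j ∘ fsuc))) * E) (toℚ-* b₀ (constC h (a ∘ fsuc))) ⟨
  (toℚ (constC (suc h) a) * invProdJ j) * E ∎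
  where
  open ℚP.≤-Reasoning
  open ℚ+*
  χ = monomial (j ∘ fsuc) (a ∘ fsuc)
  b₀ = bell (a fzero) +ℕ bell (suc (a fzero))
  B = toℚ b₀
  λ₀ = param (toℕ (j fzero))
  E = 𝔼 0 k N (λ m → toℚ (card𝓛 m))

-- Lemma 3.3.  Both partial sums are taken over the same box {0,…,N}ᵏ.
lemma3p3 : (k : ℕ) → 1 ≤ k → (h : ℕ) → 1 ≤ h
    → (j : Fin h → Fin k) → Injective _≡_ _≡_ j
    → (a : Fin h → ℕ) → (∀ t → 1 ≤ a t)
    → ∀ (N : ℕ) (ε : ℚ) → 0ℚ <ℚ ε → ∃ λ (M : ℕ) →
        partialE k N (λ m → card𝓛 m *ℕ monomial j a m)
          ≤ℚ (toℚ (constC h a) * invProdJ j) * partialE k M card𝓛 + ε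
lemma3p3 k _ h _ j j-inj a a≥1 N ε 0<ε = N , (begin
  partialE k N (λ m → card𝓛 m *ℕ monomial j a m)    ≡⟨ partialE-𝔼 k N (λ m → card𝓛 m *ℕ monomial j a m) ⟩
  𝔼 0 k N (λ m → toℚ (card𝓛 m *ℕ monomial j a m))   ≤⟨ truncated-bound k N h j j-inj a a≥1 ⟩
  C * 𝔼 0 k N (λ m → toℚ (card𝓛 m))                ≡⟨ cong (C *_) (partialE-𝔼 k N card𝓛) ⟨
  C * partialE k N card𝓛                           ≡⟨ ℚP.+-identityʳ _ ⟨
  C * partialE k N card𝓛 + 0ℚ                      ≤⟨ ℚP.+-monoʳ-≤ (C * partialE k N card𝓛) (ℚP.<⇒≤ 0<ε) ⟩
  C * partialE k N card𝓛 + ε                       ∎)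
  where
  open ℚP.≤-Reasoning
  C = toℚ (constC h a) * invProdJ j
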